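{- For every integer $n\geq 0$ and every $x\in\mathbb{C}$, $$\sum_{k=0}^{\lfloor n/2\rfloor}\binom{n}{2k}(4^k-1)\bigl(144x^2(9x^2-1)\bigr)^k B_{2k}\,C_{2(n-2k)}(x) = 6nx(9x^2-1)B^*_{2(n-1)}(x).$$
   Context: $B_n$ denotes the $n$-th Bernoulli number, defined by $\sum_{n\ge0}B_n\frac{z^n}{n!}=\frac{z}{e^z-1}$. The balancing polynomials are defined by $B^*_0(x)=0$, $B^*_1(x)=1$, $B^*_n(x)=6xB^*_{n-1}(x)-B^*_{n-2}(x)$ for $n\ge2$. The Lucas-balancing polynomials are defined by $C_0(x)=1$, $C_1(x)=3x$, $C_n(x)=6xC_{n-1}(x)-C_{n-2}(x)$ for $n\ge2$. For $n=0$ the right-hand side, which carries the factor $n$, is interpreted as $0$. -}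

module Defs where

open import Level using (Level)
open import Data.Nat.Base as ℕ using (ℕ; zero; suc; ⌊_/2⌋)
open import Data.Nat.Combinatorics using (_C_)
open import Data.Rational.Base as ℚ using (ℚ; 0ℚ; 1ℚ)
open import Data.Vec.Base using (Vec; []; _∷_; lookup; tabulate; foldr; last; _∷ʳ_)
open import Data.Fin.Base using (Fin; toℕ)
open import Algebra.Bundles using (CommutativeRing)
open import Data.Integer.Base using (+_)

-- Bernoulli numbers (convention B₁ = -1/2, i.e. z/(e^z - 1)),
-- via the equivalent standard recurrence
--   B₀ = 1,  Σ_{k=0}^{n} C(n+1,k) B_k = 0  for n ≥ 1,
-- i.e. B_n = -(1/(n+1)) Σ_{k<n} C(n+1,k) B_k.

sumℚ : ∀ {m} → Vec ℚ m → ℚ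
sumℚ = foldr _ ℚ._+_ 0ℚ

ℕ→ℚ : ℕ → ℚ
ℕ→ℚ k = (+ k) ℚ./ 1

nextBern : ∀ n → Vec ℚ n → ℚ
nextBern zero    _  = 1ℚ
nextBern (suc m) bs =
  ℚ.- (((+ 1) ℚ./ suc (suc m)) ℚ.* sumℚ (tabulate (λ (i : Fin (suc m)) →
          ℕ→ℚ (suc (suc m) C toℕ i) ℚ.* lookup bs i)))

bernVec : ∀ n → Vec ℚ (suc n)
bernVec zero    = nextBern 0 [] ∷ []
bernVec (suc n) = bernVec n ∷ʳ nextBern (suc n) (bernVec n)

bernoulli : ℕ → ℚ
bernoulli n = last (bernVec n)

module RingDefs {c ℓ : Level} (R : CommutativeRing c ℓ) where
  open CommutativeRing R

  ι : ℕ → Carrier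
  ι zero    = 0#
  ι (suc k) = 1# + ι k

  pow : Carrier → ℕ → Carrier
  pow a zero    = 1#
  pow a (suc k) = a * pow a k

  sumTo : ℕ → (ℕ → Carrier) → Carrier
  sumTo zero    f = f 0
  sumTo (suc m) f = sumTo m f + f (suc m)

  balancing : ℕ → Carrier → Carrier
  balancing zero                x = 0#
  balancing (suc zero)          x = 1#
  balancing (suc (suc n))       x =
    ι 6 * x * balancing (suc n) x - balancing n x

  lucasBalancing : ℕ → Carrier → Carrier
  lucasBalancing zero           x = 1#
  lucasBalancing (suc zero)     x = ι 3 * x
  lucasBalancing (suc (suc n))  x =
    ι 6 * x * lucasBalancing (suc n) x - lucasBalancing n x

{-# OPTIONS --safe #-}
module Submission where

open import Defs
open import Data.Nat.Base using (ℕ; _∸_; ⌊_/2⌋) renaming (_*_ to _*ℕ_)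
open import Data.Nat.Combinatorics using (_C_)
open import Data.Rational.Base using (ℚ)
open import Data.Rational.Properties using (+-*-rawRing)
open import Algebra.Bundles using (CommutativeRing)
open import Algebra.Morphism.Structures using (IsRingHomomorphism)

open import Data.Nat.Base using (zero; suc; _≤_; z≤n) renaming (_+_ to _+ℕ_)
import Data.Nat.Properties as ℕ
open import Data.Nat.Combinatorics using (nCk+nC[k+1]≡[n+1]C[k+1]; k>n⇒nCk≡0; nCk≡nC[n∸k]; nC1≡n)
open import Data.Product.Base using (_×_; _,_; proj₁; proj₂; ∃-syntax)
open import Function.Base using (_∘_)
open import Data.Sum.Base using (_⊎_; inj₁; inj₂)
open import Data.Fin.Base as Fin using (Fin; toℕ; fromℕ; inject₁)
import Data.Fin.Properties as Finₚ
open import Data.Vec.Base using (Vec; []; _∷_; lookup; tabulate; _∷ʳ_)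
import Data.Vec.Properties as Vecₚ
open import Data.Maybe.Base using (Maybe; just; nothing)
open import Relation.Nullary.Decidable.Core using (yes; no)
open import Algebra.Solver.Ring.AlmostCommutativeRing using (_-Raw-AlmostCommutative⟶_; fromCommutativeRing)
open import Relation.Binary.PropositionalEquality.Core using (_≡_)
import Relation.Binary.PropositionalEquality as ≡
open import Data.Integer.Base as ℤ using (+_)
import Data.Integer.Properties as ℤₚ
open import Data.Rational.Base using (0ℚ; 1ℚ; toℚᵘ)
  renaming (_+_ to _+ℚ_; _*_ to _*ℚ_; _/_ to _/ℚ_)
import Data.Rational.Properties as ℚₚ
open import Data.Rational.Unnormalised.Base as ℚᵘ using (mkℚᵘ; *≡*)
import Data.Rational.Unnormalised.Properties as ℚᵘₚ

-- Work with exponential generating functions.  The Bernoulli recurrence says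
-- B(z)(eᶻ - 1) = z; cancelling eᶻ - 1 gives B(2z)(eᶻ + 1) = 2B(z), so
-- H(z) = B(4z) - B(2z) satisfies H(z)(eᶻ + e⁻ᶻ) = -2z e⁻ᶻ.  The even coefficients of H
-- are 4ᵏ(4ᵏ - 1)B₂ₖ, and comparing coefficients of z²ᵐ gives the tangent identity
-- Σₖ C(2m,2k) 4ᵏ(4ᵏ - 1)B₂ₖ = 2m, i.e. T̂(z) cosh z = z sinh z for
-- T̂ = Σ 4ᵏ(4ᵏ - 1)B₂ₖ z²ᵏ/(2k)!.  Dividing by eᶻ - 1 and by 2 is where φ is needed.
--
-- With M = 9x² - 1, the recurrences give Cₖ + s B*ₖ = (3x + s)ᵏ for s² = M, so
-- C₂ⱼ and 6xM B*₂ⱼ are the coefficients of e^{tz} cosh(σz) and e^{tz} σ sinh(σz),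
-- where t = 18x² - 1 and σ² = 36x²M.  The left-hand side of the theorem is the n-th
-- coefficient of T̂(σz) e^{tz} cosh(σz) = σz e^{tz} sinh(σz), and the n-th
-- coefficient of the latter is n · 6xM B*₂₍ₙ₋₁₎.

double-suc : ∀ k → 2 *ℕ suc k ≡ suc (suc (2 *ℕ k))
double-suc k = ℕ.*-suc 2 k

⌊2*n/2⌋≡n : ∀ n → ⌊ 2 *ℕ n /2⌋ ≡ n
⌊2*n/2⌋≡n zero    = ≡.refl
⌊2*n/2⌋≡n (suc n) = ≡.trans (≡.cong ⌊_/2⌋ (double-suc n)) (≡.cong suc (⌊2*n/2⌋≡n n))

⌊1+2*n/2⌋≡n : ∀ n → ⌊ suc (2 *ℕ n) /2⌋ ≡ n
⌊1+2*n/2⌋≡n zero    = ≡.refl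
⌊1+2*n/2⌋≡n (suc n) = ≡.trans (≡.cong (⌊_/2⌋ ∘ suc) (double-suc n)) (≡.cong suc (⌊1+2*n/2⌋≡n n))

[1+n]Cn≡1+n : ∀ n → suc n C n ≡ suc n
[1+n]Cn≡1+n n = ≡.trans (nCk≡nC[n∸k] (ℕ.n≤1+n n))
                        (≡.trans (≡.cong (suc n C_) (ℕ.m+n∸n≡m 1 n)) (nC1≡n (suc n)))

data Parity : ℕ → Set where
  even : ∀ m → Parity (2 *ℕ m)
  odd  : ∀ m → Parity (suc (2 *ℕ m))

parity : ∀ n → Parity n
parity zero = even 0
parity (suc n) with parity n
... | even m = odd m
... | odd m  = ≡.subst Parity (double-suc m) (even (suc m))

toℚᵘ-/ : ∀ i d → toℚᵘ (i /ℚ suc d) ℚᵘ.≃ mkℚᵘ i d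
toℚᵘ-/ i d = ℚₚ.toℚᵘ-fromℚᵘ (mkℚᵘ i d)

ℕ→ℚ-suc : ∀ k → ℕ→ℚ (suc k) ≡ 1ℚ +ℚ ℕ→ℚ k
ℕ→ℚ-suc k = ℚₚ.toℚᵘ-injective (ℚᵘₚ.≃-sym (begin
  toℚᵘ (1ℚ +ℚ ℕ→ℚ k)                   ≈⟨ ℚₚ.toℚᵘ-homo-+ 1ℚ (ℕ→ℚ k) ⟩
  toℚᵘ 1ℚ ℚᵘ.+ toℚᵘ (ℕ→ℚ k)              ≈⟨ ℚᵘₚ.+-cong (toℚᵘ-/ (+ 1) 0) (toℚᵘ-/ (+ k) 0) ⟩
  mkℚᵘ (+ 1) 0 ℚᵘ.+ mkℚᵘ (+ k) 0        ≈⟨ one-plus ⟩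
  mkℚᵘ (+ suc k) 0                      ≈⟨ ℚᵘₚ.≃-sym (toℚᵘ-/ (+ suc k) 0) ⟩
  toℚᵘ (ℕ→ℚ (suc k))                    ∎))
  where
  open ℚᵘₚ.≃-Reasoning
  one-plus : mkℚᵘ (+ 1) 0 ℚᵘ.+ mkℚᵘ (+ k) 0 ℚᵘ.≃ mkℚᵘ (+ suc k) 0
  one-plus = *≡* (≡.trans (ℤₚ.*-identityʳ _)
    (≡.trans (≡.cong₂ ℤ._+_ (ℤₚ.*-identityʳ (+ 1)) (ℤₚ.*-identityʳ (+ k))) (≡.sym (ℤₚ.*-identityʳ _))))

ℕ→ℚ-*-inverse : ∀ k → ℕ→ℚ (suc k) *ℚ ((+ 1) /ℚ suc k) ≡ 1ℚ
ℕ→ℚ-*-inverse k = ℚₚ.toℚᵘ-injective (begin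
  toℚᵘ (ℕ→ℚ (suc k) *ℚ ((+ 1) /ℚ suc k))      ≈⟨ ℚₚ.toℚᵘ-homo-* (ℕ→ℚ (suc k)) ((+ 1) /ℚ suc k) ⟩
  toℚᵘ (ℕ→ℚ (suc k)) ℚᵘ.* toℚᵘ ((+ 1) /ℚ suc k) ≈⟨ ℚᵘₚ.*-cong (toℚᵘ-/ (+ suc k) 0) (toℚᵘ-/ (+ 1) k) ⟩
  mkℚᵘ (+ suc k) 0 ℚᵘ.* mkℚᵘ (+ 1) k          ≈⟨ ℚᵘₚ.≃-sym cancel ⟩
  mkℚᵘ (+ 1) 0                                ≈⟨ ℚᵘₚ.≃-sym (toℚᵘ-/ (+ 1) 0) ⟩
  toℚᵘ 1ℚ                                     ∎)
  where
  open ℚᵘₚ.≃-Reasoning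
  cancel : mkℚᵘ (+ 1) 0 ℚᵘ.≃ mkℚᵘ (+ suc k) 0 ℚᵘ.* mkℚᵘ (+ 1) k
  cancel = *≡* (≡.trans (ℤₚ.*-identityˡ _) (≡.trans (≡.cong (λ z → + suc z) (ℕ.+-identityʳ k))
                 (≡.sym (≡.trans (ℤₚ.*-identityʳ _) (ℤₚ.*-identityʳ _)))))

Fin-fromℕ-or-inject₁ : ∀ {n} (i : Fin (suc n)) → i ≡ fromℕ n ⊎ ∃[ j ] i ≡ inject₁ j
Fin-fromℕ-or-inject₁ {zero}  Fin.zero    = inj₁ ≡.refl
Fin-fromℕ-or-inject₁ {suc n} Fin.zero    = inj₂ (Fin.zero , ≡.refl)
Fin-fromℕ-or-inject₁ {suc n} (Fin.suc i) with Fin-fromℕ-or-inject₁ i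
... | inj₁ i≡last        = inj₁ (≡.cong Fin.suc i≡last)
... | inj₂ (j , i≡inj-j) = inj₂ (Fin.suc j , ≡.cong Fin.suc i≡inj-j)

module _ {a} {A : Set a} where

  lookup-∷ʳ-fromℕ : ∀ {n} (xs : Vec A n) y → lookup (xs ∷ʳ y) (fromℕ n) ≡ y
  lookup-∷ʳ-fromℕ []       y = ≡.refl
  lookup-∷ʳ-fromℕ (x ∷ xs) y = lookup-∷ʳ-fromℕ xs y

  lookup-∷ʳ-inject₁ : ∀ {n} (xs : Vec A n) y j → lookup (xs ∷ʳ y) (inject₁ j) ≡ lookup xs j
  lookup-∷ʳ-inject₁ (x ∷ xs) y Fin.zero    = ≡.refl
  lookup-∷ʳ-inject₁ (x ∷ xs) y (Fin.suc j) = lookup-∷ʳ-inject₁ xs y j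

lookup-bernVec : ∀ n (i : Fin (suc n)) → lookup (bernVec n) i ≡ bernoulli (toℕ i)
lookup-bernVec zero    Fin.zero = ≡.refl
lookup-bernVec (suc n) i with Fin-fromℕ-or-inject₁ i
... | inj₁ ≡.refl = ≡.trans (lookup-∷ʳ-fromℕ (bernVec n) _)
  (≡.trans (≡.sym (Vecₚ.last-∷ʳ _ (bernVec n))) (≡.cong bernoulli (≡.sym (Finₚ.toℕ-fromℕ (suc n)))))
... | inj₂ (j , ≡.refl) = ≡.trans (lookup-∷ʳ-inject₁ (bernVec n) _ j)
  (≡.trans (lookup-bernVec n j) (≡.cong bernoulli (≡.sym (Finₚ.toℕ-inject₁ j))))

-- A sequence a stands for the exponential generating function Σ aₙ zⁿ/n!;
-- shift is d/dz and _⋆_ is the product, defined through the Leibniz rule.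
module Series {c ℓ} (R : CommutativeRing c ℓ) where
  open CommutativeRing R
  open RingDefs R
  open import Relation.Binary.Reasoning.Setoid setoid
  open import Algebra.Properties.CommutativeSemigroup +-commutativeSemigroup
    using () renaming (interchange to +-interchange)
  open import Algebra.Properties.CommutativeSemigroup *-commutativeSemigroup
    using () renaming (interchange to *-interchange)
  open import Algebra.Properties.Group +-group using () renaming (∙-cancelˡ to +-cancelˡ)

  Seq : Set c
  Seq = ℕ → Carrier

  infix  4 _≐_
  infixl 6 _⊕_
  infixr 8 _·_
  infixl 7 _⋆_

  _≐_ : Seq → Seq → Set ℓ
  a ≐ b = ∀ n → a n ≈ b n

  _⊕_ : Seq → Seq → Seq
  (a ⊕ b) n = a n + b n

  _·_ : Carrier → Seq → Seq
  (r · a) n = r * a n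

  shift : Seq → Seq
  shift a n = a (suc n)

  _⋆_ : Seq → Seq → Seq
  (a ⋆ b) zero    = a 0 * b 0
  (a ⋆ b) (suc n) = (shift a ⋆ b) n + (a ⋆ shift b) n

  𝟘 : Seq
  𝟘 _ = 0#

  δ : Seq
  δ zero    = 1#
  δ (suc _) = 0#

  X : Seq
  X zero          = 0#
  X (suc zero)    = 1#
  X (suc (suc _)) = 0#

  exp : Carrier → Seq
  exp = pow

  dilate : Carrier → Seq → Seq
  dilate r a n = pow r n * a n

  ⋆-cong : ∀ {a a′ b b′} → a ≐ a′ → b ≐ b′ → a ⋆ b ≐ a′ ⋆ b′
  ⋆-cong a≐a′ b≐b′ zero    = *-cong (a≐a′ 0) (b≐b′ 0)
  ⋆-cong a≐a′ b≐b′ (suc n) =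
    +-cong (⋆-cong (a≐a′ ∘ suc) b≐b′ n) (⋆-cong a≐a′ (b≐b′ ∘ suc) n)

  ⋆-congˡ : ∀ {a b b′} → b ≐ b′ → a ⋆ b ≐ a ⋆ b′
  ⋆-congˡ = ⋆-cong (λ _ → refl)

  ⋆-congʳ : ∀ {a a′ b} → a ≐ a′ → a ⋆ b ≐ a′ ⋆ b
  ⋆-congʳ a≐a′ = ⋆-cong a≐a′ (λ _ → refl)

  ⋆-comm : ∀ a b → a ⋆ b ≐ b ⋆ a
  ⋆-comm a b zero    = *-comm (a 0) (b 0)
  ⋆-comm a b (suc n) =
    trans (+-cong (⋆-comm (shift a) b n) (⋆-comm a (shift b) n)) (+-comm _ _)

  ⋆-distribʳ : ∀ a b c → (a ⊕ b) ⋆ c ≐ a ⋆ c ⊕ b ⋆ c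
  ⋆-distribʳ a b c zero    = distribʳ (c 0) (a 0) (b 0)
  ⋆-distribʳ a b c (suc n) = trans
    (+-cong (⋆-distribʳ (shift a) (shift b) c n) (⋆-distribʳ a b (shift c) n))
    (+-interchange _ _ _ _)

  ⋆-distribˡ : ∀ a b c → a ⋆ (b ⊕ c) ≐ a ⋆ b ⊕ a ⋆ c
  ⋆-distribˡ a b c n = begin
    (a ⋆ (b ⊕ c)) n         ≈⟨ ⋆-comm a (b ⊕ c) n ⟩
    ((b ⊕ c) ⋆ a) n         ≈⟨ ⋆-distribʳ b c a n ⟩
    (b ⋆ a) n + (c ⋆ a) n   ≈⟨ +-cong (⋆-comm b a n) (⋆-comm c a n) ⟩
    (a ⋆ b) n + (a ⋆ c) n   ∎

  ·-⋆ : ∀ r a b → (r · a) ⋆ b ≐ r · (a ⋆ b)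
  ·-⋆ r a b zero    = *-assoc r (a 0) (b 0)
  ·-⋆ r a b (suc n) = trans
    (+-cong (·-⋆ r (shift a) b n) (·-⋆ r a (shift b) n))
    (sym (distribˡ r _ _))

  ⋆-· : ∀ r a b → a ⋆ (r · b) ≐ r · (a ⋆ b)
  ⋆-· r a b n = trans (⋆-comm a (r · b) n)
    (trans (·-⋆ r b a n) (*-congˡ (⋆-comm b a n)))

  ⋆-assoc : ∀ a b c → (a ⋆ b) ⋆ c ≐ a ⋆ (b ⋆ c)
  ⋆-assoc a b c zero    = *-assoc (a 0) (b 0) (c 0)
  ⋆-assoc a b c (suc n) = begin
    ((shift a ⋆ b ⊕ a ⋆ shift b) ⋆ c) n + ((a ⋆ b) ⋆ shift c) n
      ≈⟨ +-congʳ (⋆-distribʳ (shift a ⋆ b) (a ⋆ shift b) c n) ⟩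
    ((shift a ⋆ b) ⋆ c) n + ((a ⋆ shift b) ⋆ c) n + ((a ⋆ b) ⋆ shift c) n
      ≈⟨ +-cong (+-cong (⋆-assoc (shift a) b c n) (⋆-assoc a (shift b) c n))
                (⋆-assoc a b (shift c) n) ⟩
    (shift a ⋆ (b ⋆ c)) n + (a ⋆ (shift b ⋆ c)) n + (a ⋆ (b ⋆ shift c)) n
      ≈⟨ +-assoc _ _ _ ⟩
    (shift a ⋆ (b ⋆ c)) n + ((a ⋆ (shift b ⋆ c)) n + (a ⋆ (b ⋆ shift c)) n)
      ≈⟨ +-congˡ (sym (⋆-distribˡ a (shift b ⋆ c) (b ⋆ shift c) n)) ⟩
    (shift a ⋆ (b ⋆ c)) n + (a ⋆ (shift b ⋆ c ⊕ b ⋆ shift c)) n ∎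

  ⋆-left-comm : ∀ a b c → a ⋆ (b ⋆ c) ≐ b ⋆ (a ⋆ c)
  ⋆-left-comm a b c n = begin
    (a ⋆ (b ⋆ c)) n ≈⟨ sym (⋆-assoc a b c n) ⟩
    ((a ⋆ b) ⋆ c) n ≈⟨ ⋆-congʳ (⋆-comm a b) n ⟩
    ((b ⋆ a) ⋆ c) n ≈⟨ ⋆-assoc b a c n ⟩
    (b ⋆ (a ⋆ c)) n ∎

  𝟘-⋆ : ∀ b → 𝟘 ⋆ b ≐ 𝟘
  𝟘-⋆ b zero    = zeroˡ (b 0)
  𝟘-⋆ b (suc n) = trans (+-cong (𝟘-⋆ b n) (𝟘-⋆ (shift b) n)) (+-identityˡ 0#)

  δ-⋆ : ∀ a → δ ⋆ a ≐ a
  δ-⋆ a zero    = *-identityˡ (a 0)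
  δ-⋆ a (suc n) = trans (+-cong (𝟘-⋆ a n) (δ-⋆ (shift a) n)) (+-identityˡ _)

  ⋆-δ : ∀ a → a ⋆ δ ≐ a
  ⋆-δ a n = trans (⋆-comm a δ n) (δ-⋆ a n)

  shift-X : shift X ≐ δ
  shift-X zero    = refl
  shift-X (suc n) = refl

  X-⋆-suc : ∀ a n → (X ⋆ a) (suc n) ≈ ι (suc n) * a n
  X-⋆-suc a zero    = begin
    1# * a 0 + 0# * a 1 ≈⟨ +-cong (*-identityˡ (a 0)) (zeroˡ (a 1)) ⟩
    a 0 + 0#            ≈⟨ +-identityʳ (a 0) ⟩
    a 0                 ≈⟨ sym (*-identityˡ (a 0)) ⟩
    1# * a 0            ≈⟨ *-congʳ (sym (+-identityʳ 1#)) ⟩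
    (1# + 0#) * a 0     ∎
  X-⋆-suc a (suc n) = begin
    (shift X ⋆ a) (suc n) + (X ⋆ shift a) (suc n)
      ≈⟨ +-cong (trans (⋆-congʳ shift-X (suc n)) (δ-⋆ a (suc n))) (X-⋆-suc (shift a) n) ⟩
    a (suc n) + ι (suc n) * a (suc n)       ≈⟨ +-congʳ (sym (*-identityˡ _)) ⟩
    1# * a (suc n) + ι (suc n) * a (suc n)  ≈⟨ sym (distribʳ _ _ _) ⟩
    (1# + ι (suc n)) * a (suc n)            ∎

  X-⋆ : ∀ a → X ⋆ a ≐ λ n → ι n * a (n ∸ 1)
  X-⋆ a zero    = refl
  X-⋆ a (suc n) = X-⋆-suc a n

  exp-⋆-exp : ∀ r s → exp r ⋆ exp s ≐ exp (r + s)
  exp-⋆-exp r s zero    = *-identityˡ 1#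
  exp-⋆-exp r s (suc n) = begin
    (r · exp r ⋆ exp s) n + (exp r ⋆ s · exp s) n
      ≈⟨ +-cong (·-⋆ r (exp r) (exp s) n) (⋆-· s (exp r) (exp s) n) ⟩
    r * (exp r ⋆ exp s) n + s * (exp r ⋆ exp s) n ≈⟨ sym (distribʳ _ r s) ⟩
    (r + s) * (exp r ⋆ exp s) n                   ≈⟨ *-congˡ (exp-⋆-exp r s n) ⟩
    (r + s) * exp (r + s) n                       ∎

  dilate-⋆ : ∀ r a b → dilate r (a ⋆ b) ≐ dilate r a ⋆ dilate r b
  dilate-⋆ r a b zero    = begin
    1# * (a 0 * b 0)          ≈⟨ *-identityˡ _ ⟩
    a 0 * b 0                 ≈⟨ sym (*-cong (*-identityˡ (a 0)) (*-identityˡ (b 0))) ⟩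
    (1# * a 0) * (1# * b 0)   ∎
  dilate-⋆ r a b (suc n) = begin
    r * pow r n * ((shift a ⋆ b) n + (a ⋆ shift b) n)
      ≈⟨ *-assoc r (pow r n) _ ⟩
    r * (pow r n * ((shift a ⋆ b) n + (a ⋆ shift b) n))
      ≈⟨ *-congˡ (distribˡ (pow r n) _ _) ⟩
    r * (dilate r (shift a ⋆ b) n + dilate r (a ⋆ shift b) n)
      ≈⟨ *-congˡ (+-cong (dilate-⋆ r (shift a) b n) (dilate-⋆ r a (shift b) n)) ⟩
    r * ((dilate r (shift a) ⋆ dilate r b) n + (dilate r a ⋆ dilate r (shift b)) n)
      ≈⟨ distribˡ r _ _ ⟩
    r * (dilate r (shift a) ⋆ dilate r b) n + r * (dilate r a ⋆ dilate r (shift b)) n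
      ≈⟨ sym (+-cong (·-⋆ r _ (dilate r b) n) (⋆-· r (dilate r a) _ n)) ⟩
    (r · dilate r (shift a) ⋆ dilate r b) n + (dilate r a ⋆ r · dilate r (shift b)) n
      ≈⟨ sym (+-cong (⋆-congʳ (shift-dilate a) n) (⋆-congˡ (shift-dilate b) n)) ⟩
    (shift (dilate r a) ⋆ dilate r b) n + (dilate r a ⋆ shift (dilate r b)) n ∎
    where
    shift-dilate : ∀ c → shift (dilate r c) ≐ r · dilate r (shift c)
    shift-dilate c n = *-assoc r (pow r n) (c (suc n))

  sumTo-cong : ∀ n {f g} → (∀ k → k ≤ n → f k ≈ g k) → sumTo n f ≈ sumTo n g
  sumTo-cong zero    f≈g = f≈g 0 z≤n
  sumTo-cong (suc n) f≈g =
    +-cong (sumTo-cong n (λ k k≤n → f≈g k (ℕ.m≤n⇒m≤1+n k≤n))) (f≈g (suc n) ℕ.≤-refl)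

  sumTo-unfoldˡ : ∀ n f → sumTo (suc n) f ≈ f 0 + sumTo n (f ∘ suc)
  sumTo-unfoldˡ zero    f = refl
  sumTo-unfoldˡ (suc n) f = trans (+-congʳ (sumTo-unfoldˡ n f)) (+-assoc _ _ _)

  sumTo-⊕ : ∀ n f g → sumTo n (f ⊕ g) ≈ sumTo n f + sumTo n g
  sumTo-⊕ zero    f g = refl
  sumTo-⊕ (suc n) f g = trans (+-congʳ (sumTo-⊕ n f g)) (+-interchange _ _ _ _)

  sumTo-· : ∀ n r f → sumTo n (r · f) ≈ r * sumTo n f
  sumTo-· zero    r f = refl
  sumTo-· (suc n) r f = trans (+-congʳ (sumTo-· n r f)) (sym (distribˡ r _ _))

  sumTo-zero : ∀ n f → (∀ k → k ≤ n → f k ≈ 0#) → sumTo n f ≈ 0#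
  sumTo-zero n f f≈0 = trans (sumTo-cong n f≈0) (sumTo-𝟘 n)
    where
    sumTo-𝟘 : ∀ n → sumTo n 𝟘 ≈ 0#
    sumTo-𝟘 zero    = refl
    sumTo-𝟘 (suc n) = trans (+-congʳ (sumTo-𝟘 n)) (+-identityˡ 0#)

  ι-+ : ∀ p q → ι (p +ℕ q) ≈ ι p + ι q
  ι-+ zero    q = sym (+-identityˡ (ι q))
  ι-+ (suc p) q = trans (+-congˡ (ι-+ p q)) (sym (+-assoc 1# (ι p) (ι q)))

  ⋆-binomial : ∀ a b → a ⋆ b ≐ λ n → sumTo n (λ k → ι (n C k) * a k * b (n ∸ k))
  ⋆-binomial a b zero    = *-congʳ (sym (trans (*-congʳ (+-identityʳ 1#)) (*-identityˡ (a 0))))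
  ⋆-binomial a b (suc n) = begin
    (shift a ⋆ b) n + (a ⋆ shift b) n
      ≈⟨ +-cong (⋆-binomial (shift a) b n) (⋆-binomial a (shift b) n) ⟩
    sumTo n P + sumTo n Q                  ≈⟨ +-congˡ (sym Q≈F₀+G) ⟩
    sumTo n P + (F 0 + sumTo n G)          ≈⟨ sym (+-assoc _ _ _) ⟩
    sumTo n P + F 0 + sumTo n G            ≈⟨ +-congʳ (+-comm _ _) ⟩
    F 0 + sumTo n P + sumTo n G            ≈⟨ +-assoc _ _ _ ⟩
    F 0 + (sumTo n P + sumTo n G)          ≈⟨ +-congˡ (sym (sumTo-⊕ n P G)) ⟩
    F 0 + sumTo n (P ⊕ G)                  ≈⟨ +-congˡ (sumTo-cong n (λ k _ → sym (pascal k))) ⟩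
    F 0 + sumTo n (F ∘ suc)                ≈⟨ sym (sumTo-unfoldˡ n F) ⟩
    sumTo (suc n) F                        ∎
    where
    F P Q G H : ℕ → Carrier
    F k = ι (suc n C k) * a k * b (suc n ∸ k)
    P k = ι (n C k) * a (suc k) * b (n ∸ k)
    Q k = ι (n C k) * a k * b (suc (n ∸ k))
    G k = ι (n C suc k) * a (suc k) * b (n ∸ k)
    H k = ι (n C k) * a k * b (suc n ∸ k)

    pascal : ∀ k → F (suc k) ≈ P k + G k
    pascal k = begin
      ι (suc n C suc k) * a (suc k) * b (n ∸ k)
        ≡⟨ ≡.cong (λ c → ι c * a (suc k) * b (n ∸ k)) (≡.sym (nCk+nC[k+1]≡[n+1]C[k+1] n k)) ⟩
      ι (n C k +ℕ n C suc k) * a (suc k) * b (n ∸ k)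
        ≈⟨ *-congʳ (trans (*-congʳ (ι-+ (n C k) (n C suc k))) (distribʳ _ _ _)) ⟩
      (ι (n C k) * a (suc k) + ι (n C suc k) * a (suc k)) * b (n ∸ k)
        ≈⟨ distribʳ _ _ _ ⟩
      P k + G k ∎

    Q≈F₀+G : F 0 + sumTo n G ≈ sumTo n Q
    Q≈F₀+G = begin
      F 0 + sumTo n G     ≈⟨ sym (sumTo-unfoldˡ n H) ⟩
      sumTo n H + H (suc n)
        ≈⟨ +-cong (sumTo-cong n λ k k≤n →
                     reflexive (≡.cong (λ j → ι (n C k) * a k * b j) (ℕ.+-∸-assoc 1 k≤n)))
                  (trans (*-congʳ (trans (*-congʳ (reflexive (≡.cong ι (k>n⇒nCk≡0 (ℕ.n<1+n n)))))
                                         (zeroˡ _)))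
                         (zeroˡ _)) ⟩
      sumTo n Q + 0#      ≈⟨ +-identityʳ _ ⟩
      sumTo n Q           ∎

  pow-+ : ∀ r p q → pow r (p +ℕ q) ≈ pow r p * pow r q
  pow-+ r zero    q = sym (*-identityˡ _)
  pow-+ r (suc p) q = trans (*-congˡ (pow-+ r p q)) (sym (*-assoc r _ _))

  pow-1# : ∀ k → pow 1# k ≈ 1#
  pow-1# zero    = refl
  pow-1# (suc k) = trans (*-identityˡ _) (pow-1# k)

  pow-cong : ∀ {r s} k → r ≈ s → pow r k ≈ pow s k
  pow-cong zero    r≈s = refl
  pow-cong (suc k) r≈s = *-cong r≈s (pow-cong k r≈s)

  pow-* : ∀ r s k → pow (r * s) k ≈ pow r k * pow s k
  pow-* r s zero    = sym (*-identityˡ 1#)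
  pow-* r s (suc k) = trans (*-congˡ (pow-* r s k)) (*-interchange r s _ _)

  pow-double : ∀ r k → pow r (2 *ℕ k) ≈ pow (r * r) k
  pow-double r zero    = refl
  pow-double r (suc k) = begin
    pow r (2 *ℕ suc k)          ≡⟨ ≡.cong (pow r) (double-suc k) ⟩
    r * (r * pow r (2 *ℕ k))    ≈⟨ sym (*-assoc r r _) ⟩
    r * r * pow r (2 *ℕ k)      ≈⟨ *-congˡ (pow-double r k) ⟩
    r * r * pow (r * r) k       ∎

  atEven : Seq → Seq
  atEven a zero          = a 0
  atEven a (suc zero)    = 0#
  atEven a (suc (suc n)) = atEven (shift a) n

  atEven-double : ∀ a k → atEven a (2 *ℕ k) ≡ a k
  atEven-double a zero    = ≡.refl
  atEven-double a (suc k) = ≡.trans (≡.cong (atEven a) (double-suc k)) (atEven-double (shift a) k)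

  atEven-odd : ∀ a k → atEven a (suc (2 *ℕ k)) ≡ 0#
  atEven-odd a zero    = ≡.refl
  atEven-odd a (suc k) = ≡.trans (≡.cong (atEven a ∘ suc) (double-suc k)) (atEven-odd (shift a) k)

  atEven-cong : ∀ {a b} → a ≐ b → atEven a ≐ atEven b
  atEven-cong a≐b zero          = a≐b 0
  atEven-cong a≐b (suc zero)    = refl
  atEven-cong a≐b (suc (suc n)) = atEven-cong (a≐b ∘ suc) n

  atEven-· : ∀ r a → atEven (r · a) ≐ r · atEven a
  atEven-· r a zero          = refl
  atEven-· r a (suc zero)    = sym (zeroʳ r)
  atEven-· r a (suc (suc n)) = atEven-· r (shift a) n

  sumTo-evens : ∀ n f → (∀ k → f (suc (2 *ℕ k)) ≈ 0#) →
                sumTo n f ≈ sumTo ⌊ n /2⌋ (f ∘ (2 *ℕ_))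
  sumTo-evens zero          f odd≈0 = refl
  sumTo-evens (suc zero)    f odd≈0 = trans (+-congˡ (odd≈0 0)) (+-identityʳ (f 0))
  sumTo-evens (suc (suc n)) f odd≈0 = begin
    sumTo (suc (suc n)) f                   ≈⟨ sumTo-unfoldˡ (suc n) f ⟩
    f 0 + sumTo (suc n) (f ∘ suc)           ≈⟨ +-congˡ (sumTo-unfoldˡ n (f ∘ suc)) ⟩
    f 0 + (f 1 + sumTo n (f ∘ suc ∘ suc))   ≈⟨ +-congˡ (trans (+-congʳ (odd≈0 0)) (+-identityˡ _)) ⟩
    f 0 + sumTo n (f ∘ suc ∘ suc)
      ≈⟨ +-congˡ (sumTo-evens n (f ∘ suc ∘ suc) λ k →
                    trans (reflexive (≡.cong (f ∘ suc) (≡.sym (double-suc k)))) (odd≈0 (suc k))) ⟩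
    f 0 + sumTo ⌊ n /2⌋ (λ k → f (suc (suc (2 *ℕ k))))
      ≈⟨ +-congˡ (sumTo-cong ⌊ n /2⌋ λ k _ → reflexive (≡.cong f (≡.sym (double-suc k)))) ⟩
    f 0 + sumTo ⌊ n /2⌋ (λ k → f (2 *ℕ suc k)) ≈⟨ sym (sumTo-unfoldˡ ⌊ n /2⌋ (f ∘ (2 *ℕ_))) ⟩
    sumTo (suc ⌊ n /2⌋) (f ∘ (2 *ℕ_))        ∎

  atEven-⋆ : ∀ a b → atEven a ⋆ b ≐ λ n →
             sumTo ⌊ n /2⌋ (λ k → ι (n C 2 *ℕ k) * a k * b (n ∸ 2 *ℕ k))
  atEven-⋆ a b n = begin
    (atEven a ⋆ b) n
      ≈⟨ ⋆-binomial (atEven a) b n ⟩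
    sumTo n (λ j → ι (n C j) * atEven a j * b (n ∸ j))
      ≈⟨ sumTo-evens n _ (λ k → trans (*-congʳ (trans (*-congˡ (reflexive (atEven-odd a k)))
                                                       (zeroʳ _)))
                                      (zeroˡ _)) ⟩
    sumTo ⌊ n /2⌋ (λ k → ι (n C 2 *ℕ k) * atEven a (2 *ℕ k) * b (n ∸ 2 *ℕ k))
      ≈⟨ sumTo-cong ⌊ n /2⌋ (λ k _ → *-congʳ (*-congˡ (reflexive (atEven-double a k)))) ⟩
    sumTo ⌊ n /2⌋ (λ k → ι (n C 2 *ℕ k) * a k * b (n ∸ 2 *ℕ k)) ∎

  atEven-⋆-atEven-odd : ∀ a b m → (atEven a ⋆ atEven b) (suc (2 *ℕ m)) ≈ 0#
  atEven-⋆-atEven-odd a b m =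
    trans (atEven-⋆ a (atEven b) (suc (2 *ℕ m)))
          (sumTo-zero ⌊ suc (2 *ℕ m) /2⌋ _ λ k k≤ →
             trans (*-congˡ (reflexive (odd-index k (≡.subst (k ≤_) (⌊1+2*n/2⌋≡n m) k≤))))
                   (zeroʳ _))
    where
    odd-index : ∀ k → k ≤ m → atEven b (suc (2 *ℕ m) ∸ 2 *ℕ k) ≡ 0#
    odd-index k k≤m = ≡.trans
      (≡.cong (atEven b) (≡.trans (ℕ.+-∸-assoc 1 (ℕ.*-monoʳ-≤ 2 k≤m))
                                  (≡.cong suc (≡.sym (ℕ.*-distribˡ-∸ 2 m k)))))
      (atEven-odd b (m ∸ k))

  -- For N = s², ch N and sh N are the coefficients of cosh (s z) and s sinh (s z).
  ch : Carrier → Seq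
  ch N = atEven (pow N)

  sh : Carrier → Seq
  sh N zero    = 0#
  sh N (suc n) = atEven (shift (pow N)) n

  shift-ch : ∀ N → shift (ch N) ≐ sh N
  shift-ch N zero    = refl
  shift-ch N (suc n) = refl

  shift-sh : ∀ N → shift (sh N) ≐ N · ch N
  shift-sh N = atEven-· N (pow N)

  sh-double : ∀ N m → sh N (2 *ℕ m) ≡ 0#
  sh-double N zero    = ≡.refl
  sh-double N (suc m) =
    ≡.trans (≡.cong (sh N) (double-suc m)) (atEven-odd (shift (pow N)) m)

  sh-odd : ∀ N m → sh N (suc (2 *ℕ m)) ≡ pow N (suc m)
  sh-odd N m = atEven-double (shift (pow N)) m

  coupled-recurrence : ∀ t N u v → u 0 ≈ 1# → v 0 ≈ 0# →
    (∀ j → u (suc j) ≈ t * u j + v j) → (∀ j → v (suc j) ≈ t * v j + N * u j) →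
    u ≐ exp t ⋆ ch N × v ≐ exp t ⋆ sh N
  coupled-recurrence t N u v u₀ v₀ u-step v-step =
    (λ n → proj₁ (both n)) , (λ n → proj₂ (both n))
    where
    both : ∀ n → u n ≈ (exp t ⋆ ch N) n × v n ≈ (exp t ⋆ sh N) n
    both zero    = trans u₀ (sym (*-identityˡ 1#)) , trans v₀ (sym (*-identityˡ 0#))
    both (suc n) with both n
    ... | uₙ , vₙ =
      (begin
        u (suc n)                                        ≈⟨ u-step n ⟩
        t * u n + v n                                    ≈⟨ +-cong (*-congˡ uₙ) vₙ ⟩
        t * (exp t ⋆ ch N) n + (exp t ⋆ sh N) n
          ≈⟨ sym (+-cong (·-⋆ t (exp t) (ch N) n) (⋆-congˡ (shift-ch N) n)) ⟩
        (exp t ⋆ ch N) (suc n)                           ∎)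
      , (begin
        v (suc n)                                        ≈⟨ v-step n ⟩
        t * v n + N * u n                                ≈⟨ +-cong (*-congˡ vₙ) (*-congˡ uₙ) ⟩
        t * (exp t ⋆ sh N) n + N * (exp t ⋆ ch N) n
          ≈⟨ sym (+-cong (·-⋆ t (exp t) (sh N) n)
                         (trans (⋆-congˡ (shift-sh N) n) (⋆-· N (exp t) (ch N) n))) ⟩
        (exp t ⋆ sh N) (suc n)                           ∎)

  -- With T̂ = Σ Tₖ z²ᵏ/(2k)!, the hypothesis is T̂(z) cosh z = z sinh z (its odd
  -- coefficients vanish trivially); the conclusion is the same with z replaced by s z.
  ch-dilation : ∀ (N : Carrier) (T : Seq) →
    (∀ m → sumTo m (λ k → ι (2 *ℕ m C 2 *ℕ k) * T (m ∸ k)) ≈ ι (2 *ℕ m)) →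
    atEven (λ k → pow N k * T k) ⋆ ch N ≐ X ⋆ sh N
  ch-dilation N T tangent n with parity n
  ... | odd m  = begin
    (atEven g ⋆ ch N) (suc (2 *ℕ m))    ≈⟨ atEven-⋆-atEven-odd g (pow N) m ⟩
    0#                                  ≈⟨ sym (zeroʳ _) ⟩
    ι (suc (2 *ℕ m)) * 0#               ≡⟨ ≡.cong (ι (suc (2 *ℕ m)) *_) (≡.sym (sh-double N m)) ⟩
    ι (suc (2 *ℕ m)) * sh N (2 *ℕ m)    ≈⟨ sym (X-⋆ (sh N) (suc (2 *ℕ m))) ⟩
    (X ⋆ sh N) (suc (2 *ℕ m))           ∎
    where
    g : ℕ → Carrier
    g k = pow N k * T k
  ... | even m = begin
    (atEven g ⋆ ch N) (2 *ℕ m)        ≈⟨ ⋆-comm (atEven g) (ch N) (2 *ℕ m) ⟩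
    (ch N ⋆ atEven g) (2 *ℕ m)        ≈⟨ atEven-⋆ (pow N) (atEven g) (2 *ℕ m) ⟩
    sumTo ⌊ 2 *ℕ m /2⌋ F              ≡⟨ ≡.cong (λ j → sumTo j F) (⌊2*n/2⌋≡n m) ⟩
    sumTo m F                         ≈⟨ sumTo-cong m term ⟩
    sumTo m (pow N m · G)             ≈⟨ sumTo-· m (pow N m) G ⟩
    pow N m * sumTo m G               ≈⟨ *-congˡ (tangent m) ⟩
    pow N m * ι (2 *ℕ m)              ≈⟨ sym (X-⋆-sh-double m) ⟩
    (X ⋆ sh N) (2 *ℕ m)               ∎
    where
    g F G : ℕ → Carrier
    g k = pow N k * T k
    F k = ι (2 *ℕ m C 2 *ℕ k) * pow N k * atEven g (2 *ℕ m ∸ 2 *ℕ k)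
    G k = ι (2 *ℕ m C 2 *ℕ k) * T (m ∸ k)

    term : ∀ k → k ≤ m → F k ≈ pow N m * G k
    term k k≤m = begin
      ι (2 *ℕ m C 2 *ℕ k) * pow N k * atEven g (2 *ℕ m ∸ 2 *ℕ k)
        ≡⟨ ≡.cong (λ j → ι (2 *ℕ m C 2 *ℕ k) * pow N k * atEven g j) (≡.sym (ℕ.*-distribˡ-∸ 2 m k)) ⟩
      ι (2 *ℕ m C 2 *ℕ k) * pow N k * atEven g (2 *ℕ (m ∸ k))
        ≡⟨ ≡.cong (ι (2 *ℕ m C 2 *ℕ k) * pow N k *_) (atEven-double g (m ∸ k)) ⟩
      ι (2 *ℕ m C 2 *ℕ k) * pow N k * (pow N (m ∸ k) * T (m ∸ k))
        ≈⟨ *-congʳ (*-comm _ _) ⟩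
      pow N k * ι (2 *ℕ m C 2 *ℕ k) * (pow N (m ∸ k) * T (m ∸ k))
        ≈⟨ *-interchange _ _ _ _ ⟩
      pow N k * pow N (m ∸ k) * G k
        ≈⟨ *-congʳ (trans (sym (pow-+ N k (m ∸ k))) (reflexive (≡.cong (pow N) (ℕ.m+[n∸m]≡n k≤m)))) ⟩
      pow N m * G k ∎

    X-⋆-sh-double : ∀ m → (X ⋆ sh N) (2 *ℕ m) ≈ pow N m * ι (2 *ℕ m)
    X-⋆-sh-double zero    = trans (zeroˡ 0#) (sym (zeroʳ 1#))
    X-⋆-sh-double (suc m) = begin
      (X ⋆ sh N) (2 *ℕ suc m)                    ≈⟨ X-⋆ (sh N) (2 *ℕ suc m) ⟩
      ι (2 *ℕ suc m) * sh N (2 *ℕ suc m ∸ 1)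
        ≡⟨ ≡.cong (λ j → ι (2 *ℕ suc m) * sh N (j ∸ 1)) (double-suc m) ⟩
      ι (2 *ℕ suc m) * sh N (suc (2 *ℕ m))       ≡⟨ ≡.cong (ι (2 *ℕ suc m) *_) (sh-odd N m) ⟩
      ι (2 *ℕ suc m) * pow N (suc m)             ≈⟨ *-comm _ _ ⟩
      pow N (suc m) * ι (2 *ℕ suc m)             ∎

  expm1 : Seq
  expm1 zero    = 0#
  expm1 (suc _) = 1#

  ⋆-expm1 : ∀ a n → (a ⋆ expm1) (suc n) ≈ sumTo n (λ k → ι (suc n C k) * a k)
  ⋆-expm1 a n = begin
    (a ⋆ expm1) (suc n)                              ≈⟨ ⋆-binomial a expm1 (suc n) ⟩
    sumTo n F + ι (suc n C suc n) * a (suc n) * expm1 (suc n ∸ suc n)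
      ≡⟨ ≡.cong (λ j → sumTo n F + ι (suc n C suc n) * a (suc n) * expm1 j) (ℕ.n∸n≡0 n) ⟩
    sumTo n F + ι (suc n C suc n) * a (suc n) * 0#   ≈⟨ +-congˡ (zeroʳ _) ⟩
    sumTo n F + 0#                                   ≈⟨ +-identityʳ _ ⟩
    sumTo n F
      ≈⟨ sumTo-cong n (λ k k≤n → trans (*-congˡ (reflexive (≡.cong expm1 (ℕ.+-∸-assoc 1 k≤n))))
                                       (*-identityʳ _)) ⟩
    sumTo n (λ k → ι (suc n C k) * a k)              ∎
    where
    F : ℕ → Carrier
    F k = ι (suc n C k) * a k * expm1 (suc n ∸ k)

  module _ (ι⁻¹ : ℕ → Carrier) (ι⁻¹-inverse : ∀ k → ι⁻¹ k * ι (suc k) ≈ 1#) where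

    ι-suc-cancel : ∀ k {a b} → ι (suc k) * a ≈ ι (suc k) * b → a ≈ b
    ι-suc-cancel k {a} {b} eq = begin
      a                       ≈⟨ sym (trans (*-congʳ (ι⁻¹-inverse k)) (*-identityˡ a)) ⟩
      ι⁻¹ k * ι (suc k) * a   ≈⟨ *-assoc _ _ _ ⟩
      ι⁻¹ k * (ι (suc k) * a) ≈⟨ *-congˡ eq ⟩
      ι⁻¹ k * (ι (suc k) * b) ≈⟨ sym (*-assoc _ _ _) ⟩
      ι⁻¹ k * ι (suc k) * b   ≈⟨ trans (*-congʳ (ι⁻¹-inverse k)) (*-identityˡ b) ⟩
      b                       ∎

    -- The n-th coefficient of a ⋆ expm1 is (n + 1) aₙ plus a combination of
    -- earlier coefficients of a, so a can be recovered from it.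
    ⋆-expm1-cancel : ∀ a b → a ⋆ expm1 ≐ b ⋆ expm1 → a ≐ b
    ⋆-expm1-cancel a b eq n = agree n n ℕ.≤-refl
      where
      top : ∀ n → ι (suc n C n) * a n ≈ ι (suc n C n) * b n → a n ≈ b n
      top n eqₙ = ι-suc-cancel n (begin
        ι (suc n) * a n      ≡⟨ ≡.cong (λ c → ι c * a n) (≡.sym ([1+n]Cn≡1+n n)) ⟩
        ι (suc n C n) * a n  ≈⟨ eqₙ ⟩
        ι (suc n C n) * b n  ≡⟨ ≡.cong (λ c → ι c * b n) ([1+n]Cn≡1+n n) ⟩
        ι (suc n) * b n      ∎)

      agree : ∀ n k → k ≤ n → a k ≈ b k
      agree zero    .0 z≤n = top 0 (trans (sym (⋆-expm1 a 0)) (trans (eq 1) (⋆-expm1 b 0)))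
      agree (suc n) k k≤1+n with ℕ.m≤n⇒m<n∨m≡n k≤1+n
      ... | inj₁ k<1+n     = agree n k (ℕ.≤-pred k<1+n)
      ... | inj₂ ≡.refl    = top (suc n) (+-cancelˡ (sumTo n (λ j → ι (suc (suc n) C j) * a j)) _ _ (begin
        sumTo n (λ j → ι (suc (suc n) C j) * a j) + ι (suc (suc n) C suc n) * a (suc n)
          ≈⟨ sym (⋆-expm1 a (suc n)) ⟩
        (a ⋆ expm1) (suc (suc n))                         ≈⟨ eq (suc (suc n)) ⟩
        (b ⋆ expm1) (suc (suc n))                         ≈⟨ ⋆-expm1 b (suc n) ⟩
        sumTo n (λ j → ι (suc (suc n) C j) * b j) + ι (suc (suc n) C suc n) * b (suc n)
          ≈⟨ +-congʳ (sumTo-cong n (λ j j≤n → *-congˡ (sym (agree n j j≤n)))) ⟩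
        sumTo n (λ j → ι (suc (suc n) C j) * a j) + ι (suc (suc n) C suc n) * b (suc n) ∎))

module ℚ-Algebra {c ℓ} (R : CommutativeRing c ℓ) (φ : ℚ → CommutativeRing.Carrier R)
  (φ-hom : IsRingHomomorphism +-*-rawRing (CommutativeRing.rawRing R) φ) where

  open CommutativeRing R
  open RingDefs R
  open IsRingHomomorphism φ-hom
  open import Relation.Binary.Reasoning.Setoid setoid

  -- φ′ agrees with φ but sends 0ℚ and 1ℚ to 0# and 1# on the nose, so that the
  -- solver constant numeral k evaluates to ι k by computation.
  φ′ : ℚ → Carrier
  φ′ q with q ℚₚ.≟ 0ℚ | q ℚₚ.≟ 1ℚ
  ... | yes _ | _     = 0#
  ... | no _  | yes _ = 1#
  ... | no _  | no _  = φ q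

  φ′≈φ : ∀ q → φ′ q ≈ φ q
  φ′≈φ q with q ℚₚ.≟ 0ℚ | q ℚₚ.≟ 1ℚ
  ... | yes ≡.refl | _          = sym 0#-homo
  ... | no _       | yes ≡.refl = sym 1#-homo
  ... | no _       | no _       = refl

  φ′-morphism : +-*-rawRing -Raw-AlmostCommutative⟶ fromCommutativeRing R
  φ′-morphism = record
    { ⟦_⟧    = φ′
    ; +-homo = λ p q → trans (φ′≈φ _) (trans (+-homo p q) (sym (+-cong (φ′≈φ p) (φ′≈φ q))))
    ; *-homo = λ p q → trans (φ′≈φ _) (trans (*-homo p q) (sym (*-cong (φ′≈φ p) (φ′≈φ q))))
    ; -‿homo = λ p → trans (φ′≈φ _) (trans (-‿homo p) (sym (-‿cong (φ′≈φ p))))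
    ; 0-homo = trans (φ′≈φ _) 0#-homo
    ; 1-homo = trans (φ′≈φ _) 1#-homo
    }

  φ′-≟ : ∀ p q → Maybe (φ′ p ≈ φ′ q)
  φ′-≟ p q with p ℚₚ.≟ q
  ... | yes p≡q = just (reflexive (≡.cong φ′ p≡q))
  ... | no _    = nothing

  open import Algebra.Solver.Ring +-*-rawRing (fromCommutativeRing R) φ′-morphism φ′-≟ public

  numeral : ∀ {m} → ℕ → Polynomial m
  numeral zero    = con 0ℚ
  numeral (suc k) = con 1ℚ :+ numeral k

  φ-ℕ→ℚ : ∀ k → φ (ℕ→ℚ k) ≈ ι k
  φ-ℕ→ℚ zero    = 0#-homo
  φ-ℕ→ℚ (suc k) = trans (reflexive (≡.cong φ (ℕ→ℚ-suc k)))
                        (trans (+-homo _ _) (+-cong 1#-homo (φ-ℕ→ℚ k)))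

  ι⁻¹ : ℕ → Carrier
  ι⁻¹ k = φ ((+ 1) /ℚ suc k)

  ι⁻¹-inverse : ∀ k → ι⁻¹ k * ι (suc k) ≈ 1#
  ι⁻¹-inverse k = begin
    ι⁻¹ k * ι (suc k)                      ≈⟨ *-comm _ _ ⟩
    ι (suc k) * ι⁻¹ k                      ≈⟨ *-congʳ (sym (φ-ℕ→ℚ (suc k))) ⟩
    φ (ℕ→ℚ (suc k)) * φ ((+ 1) /ℚ suc k)   ≈⟨ sym (*-homo _ _) ⟩
    φ (ℕ→ℚ (suc k) *ℚ ((+ 1) /ℚ suc k))    ≡⟨ ≡.cong φ (ℕ→ℚ-*-inverse k) ⟩
    φ 1ℚ                                   ≈⟨ 1#-homo ⟩
    1#                                     ∎

module Bernoulli {c ℓ} (R : CommutativeRing c ℓ) (φ : ℚ → CommutativeRing.Carrier R)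
  (φ-hom : IsRingHomomorphism +-*-rawRing (CommutativeRing.rawRing R) φ) where

  open CommutativeRing R
  open RingDefs R
  open IsRingHomomorphism φ-hom
  open Series R
  open ℚ-Algebra R φ φ-hom
  open import Relation.Binary.Reasoning.Setoid setoid
  open import Algebra.Properties.Ring ring using (-‿distribʳ-*)

  β : Seq
  β n = φ (bernoulli n)

  φ-sumℚ-tabulate : ∀ m (f : Fin (suc m) → ℚ) (g : Seq) → (∀ i → φ (f i) ≈ g (toℕ i)) →
                    φ (sumℚ (tabulate f)) ≈ sumTo m g
  φ-sumℚ-tabulate zero    f g φf≈g =
    trans (+-homo _ _) (trans (+-cong (φf≈g Fin.zero) 0#-homo) (+-identityʳ _))
  φ-sumℚ-tabulate (suc m) f g φf≈g = begin
    φ (sumℚ (tabulate f))                            ≈⟨ +-homo _ _ ⟩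
    φ (f Fin.zero) + φ (sumℚ (tabulate (f ∘ Fin.suc)))
      ≈⟨ +-cong (φf≈g Fin.zero) (φ-sumℚ-tabulate m (f ∘ Fin.suc) (g ∘ suc) (φf≈g ∘ Fin.suc)) ⟩
    g 0 + sumTo m (g ∘ suc)                          ≈⟨ sym (sumTo-unfoldˡ m g) ⟩
    sumTo (suc m) g                                  ∎

  β-suc : ∀ m → β (suc m) ≈ - (ι⁻¹ (suc m) * sumTo m (λ i → ι (suc (suc m) C i) * β i))
  β-suc m = begin
    φ (bernoulli (suc m))                     ≡⟨ ≡.cong φ (Vecₚ.last-∷ʳ _ (bernVec m)) ⟩
    φ (nextBern (suc m) (bernVec m))          ≈⟨ -‿homo _ ⟩
    - φ (((+ 1) /ℚ suc (suc m)) *ℚ sumℚ (tabulate F)) ≈⟨ -‿cong (*-homo _ _) ⟩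
    - (ι⁻¹ (suc m) * φ (sumℚ (tabulate F)))
      ≈⟨ -‿cong (*-congˡ (φ-sumℚ-tabulate m F (λ i → ι (suc (suc m) C i) * β i) λ i →
           trans (*-homo _ _) (*-cong (φ-ℕ→ℚ (suc (suc m) C toℕ i))
                                      (reflexive (≡.cong φ (lookup-bernVec m i)))))) ⟩
    - (ι⁻¹ (suc m) * sumTo m (λ i → ι (suc (suc m) C i) * β i)) ∎
    where
    F : Fin (suc m) → ℚ
    F i = ℕ→ℚ (suc (suc m) C toℕ i) *ℚ lookup (bernVec m) i

  β⋆expm1 : β ⋆ expm1 ≐ X
  β⋆expm1 zero          = zeroʳ _
  β⋆expm1 (suc zero)    = trans (⋆-expm1 β 0) (trans (*-cong (+-identityʳ 1#) 1#-homo) (*-identityʳ 1#))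
  β⋆expm1 (suc (suc m)) = begin
    (β ⋆ expm1) (suc (suc m))                         ≈⟨ ⋆-expm1 β (suc m) ⟩
    S + ι (suc (suc m) C suc m) * β (suc m)
      ≈⟨ +-congˡ (*-cong (reflexive (≡.cong ι ([1+n]Cn≡1+n (suc m)))) (β-suc m)) ⟩
    S + ι (suc (suc m)) * - (ι⁻¹ (suc m) * S)        ≈⟨ +-congˡ (sym (-‿distribʳ-* _ _)) ⟩
    S + - (ι (suc (suc m)) * (ι⁻¹ (suc m) * S))
      ≈⟨ +-congˡ (-‿cong (trans (sym (*-assoc _ _ _))
                               (trans (*-congʳ (trans (*-comm _ _) (ι⁻¹-inverse (suc m))))
                                      (*-identityˡ S)))) ⟩
    S + - S                                           ≈⟨ -‿inverseʳ S ⟩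
    0#                                                ∎
    where
    S : Carrier
    S = sumTo m (λ i → ι (suc (suc m) C i) * β i)

  pow-[-1]-odd : ∀ m → pow (- 1#) (suc (2 *ℕ m)) ≈ - 1#
  pow-[-1]-odd zero    = *-identityʳ (- 1#)
  pow-[-1]-odd (suc m) = begin
    pow (- 1#) (suc (2 *ℕ suc m))                    ≡⟨ ≡.cong (pow (- 1#) ∘ suc) (double-suc m) ⟩
    - 1# * (- 1# * pow (- 1#) (suc (2 *ℕ m)))        ≈⟨ *-congˡ (*-congˡ (pow-[-1]-odd m)) ⟩
    - 1# * (- 1# * - 1#)
      ≈⟨ solve 0 (:- con 1ℚ :* (:- con 1ℚ :* :- con 1ℚ) := :- con 1ℚ) refl ⟩
    - 1#                                             ∎

  ι2≈1+1 : ι 2 ≈ 1# + 1#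
  ι2≈1+1 = solve 0 (numeral 2 := con 1ℚ :+ con 1ℚ) refl

  E : Seq
  E = exp 1#

  expm1≐E-δ : expm1 ≐ E ⊕ (- 1#) · δ
  expm1≐E-δ zero    = solve 0 (con 0ℚ := con 1ℚ :+ :- con 1ℚ :* con 1ℚ) refl
  expm1≐E-δ (suc n) = sym (trans (+-cong (pow-1# (suc n)) (zeroʳ _)) (+-identityʳ 1#))

  E+δ≐expm1+2δ : E ⊕ δ ≐ expm1 ⊕ ι 2 · δ
  E+δ≐expm1+2δ zero    = solve 0 (con 1ℚ :+ con 1ℚ := con 0ℚ :+ numeral 2 :* con 1ℚ) refl
  E+δ≐expm1+2δ (suc n) = begin
    pow 1# (suc n) + 0#   ≈⟨ +-congʳ (pow-1# (suc n)) ⟩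
    1# + 0#               ≈⟨ solve 0 (con 1ℚ :+ con 0ℚ := con 1ℚ :+ numeral 2 :* con 0ℚ) refl ⟩
    1# + ι 2 * 0#         ∎

  dilate-2-X : dilate (ι 2) X ≐ ι 2 · X
  dilate-2-X zero          = solve 0 (con 1ℚ :* con 0ℚ := numeral 2 :* con 0ℚ) refl
  dilate-2-X (suc zero)    = solve 0 (numeral 2 :* con 1ℚ :* con 1ℚ := numeral 2 :* con 1ℚ) refl
  dilate-2-X (suc (suc n)) =
    solve 1 (λ p → p :* con 0ℚ := numeral 2 :* con 0ℚ) refl (pow (ι 2) (suc (suc n)))

  E+δ⋆expm1 : (E ⊕ δ) ⋆ expm1 ≐ dilate (ι 2) expm1
  E+δ⋆expm1 n = begin
    ((E ⊕ δ) ⋆ expm1) n                          ≈⟨ ⋆-distribʳ E δ expm1 n ⟩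
    (E ⋆ expm1) n + (δ ⋆ expm1) n                ≈⟨ +-cong (⋆-congˡ expm1≐E-δ n) (δ-⋆ expm1 n) ⟩
    (E ⋆ (E ⊕ (- 1#) · δ)) n + expm1 n
      ≈⟨ +-congʳ (trans (⋆-distribˡ E E _ n) (+-congˡ (⋆-· (- 1#) E δ n))) ⟩
    (E ⋆ E) n + - 1# * (E ⋆ δ) n + expm1 n
      ≈⟨ +-congʳ (+-cong (trans (exp-⋆-exp 1# 1# n) (pow-cong n (sym ι2≈1+1)))
                         (*-congˡ (trans (⋆-δ E n) (pow-1# n)))) ⟩
    pow (ι 2) n + - 1# * 1# + expm1 n            ≈⟨ cases n ⟩
    dilate (ι 2) expm1 n                         ∎
    where
    cases : ∀ n → pow (ι 2) n + - 1# * 1# + expm1 n ≈ dilate (ι 2) expm1 n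
    cases zero    = solve 0 (con 1ℚ :+ :- con 1ℚ :* con 1ℚ :+ con 0ℚ := con 1ℚ :* con 0ℚ) refl
    cases (suc n) = solve 1 (λ p → p :+ :- con 1ℚ :* con 1ℚ :+ con 1ℚ := p :* con 1ℚ) refl
                            (pow (ι 2) (suc n))

  dilate-β⋆E+δ : dilate (ι 2) β ⋆ (E ⊕ δ) ≐ ι 2 · β
  dilate-β⋆E+δ = ⋆-expm1-cancel ι⁻¹ ι⁻¹-inverse _ _ λ n → begin
    (dilate (ι 2) β ⋆ (E ⊕ δ) ⋆ expm1) n          ≈⟨ ⋆-assoc _ _ _ n ⟩
    (dilate (ι 2) β ⋆ ((E ⊕ δ) ⋆ expm1)) n        ≈⟨ ⋆-congˡ E+δ⋆expm1 n ⟩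
    (dilate (ι 2) β ⋆ dilate (ι 2) expm1) n       ≈⟨ sym (dilate-⋆ (ι 2) β expm1 n) ⟩
    dilate (ι 2) (β ⋆ expm1) n                    ≈⟨ *-congˡ (β⋆expm1 n) ⟩
    dilate (ι 2) X n                              ≈⟨ dilate-2-X n ⟩
    ι 2 * X n                                     ≈⟨ *-congˡ (sym (β⋆expm1 n)) ⟩
    ι 2 * (β ⋆ expm1) n                           ≈⟨ sym (·-⋆ (ι 2) β expm1 n) ⟩
    (ι 2 · β ⋆ expm1) n                           ∎

  h : Seq
  h = dilate (ι 2) β ⊕ (- 1#) · β

  h⋆E+δ : h ⋆ (E ⊕ δ) ≐ (- 1#) · X
  h⋆E+δ n = begin
    (h ⋆ (E ⊕ δ)) n
      ≈⟨ ⋆-distribʳ (dilate (ι 2) β) ((- 1#) · β) (E ⊕ δ) n ⟩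
    (dilate (ι 2) β ⋆ (E ⊕ δ)) n + ((- 1#) · β ⋆ (E ⊕ δ)) n
      ≈⟨ +-cong (dilate-β⋆E+δ n) (·-⋆ (- 1#) β (E ⊕ δ) n) ⟩
    ι 2 * β n + - 1# * (β ⋆ (E ⊕ δ)) n
      ≈⟨ +-congˡ (*-congˡ (trans (⋆-congˡ E+δ≐expm1+2δ n) (⋆-distribˡ β expm1 (ι 2 · δ) n))) ⟩
    ι 2 * β n + - 1# * ((β ⋆ expm1) n + (β ⋆ ι 2 · δ) n)
      ≈⟨ +-congˡ (*-congˡ (+-cong (β⋆expm1 n) (trans (⋆-· (ι 2) β δ n) (*-congˡ (⋆-δ β n))))) ⟩
    ι 2 * β n + - 1# * (X n + ι 2 * β n)
      ≈⟨ solve 2 (λ b x → numeral 2 :* b :+ :- con 1ℚ :* (x :+ numeral 2 :* b) := :- con 1ℚ :* x)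
               refl (β n) (X n) ⟩
    - 1# * X n ∎

  E+exp[-1]≐2cosh : ∀ n → pow 1# n + pow (- 1#) n ≈ atEven (λ _ → ι 2) n
  E+exp[-1]≐2cosh zero          = sym ι2≈1+1
  E+exp[-1]≐2cosh (suc zero)    = solve 0 (con 1ℚ :* con 1ℚ :+ :- con 1ℚ :* con 1ℚ := con 0ℚ) refl
  E+exp[-1]≐2cosh (suc (suc n)) = trans
    (solve 2 (λ p q → con 1ℚ :* (con 1ℚ :* p) :+ :- con 1ℚ :* (:- con 1ℚ :* q) := p :+ q)
             refl (pow 1# n) (pow (- 1#) n))
    (E+exp[-1]≐2cosh n)

  dilate-E+δ⋆exp[-1] : dilate (ι 2) (E ⊕ δ) ⋆ exp (- 1#) ≐ atEven (λ _ → ι 2)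
  dilate-E+δ⋆exp[-1] n = begin
    (dilate (ι 2) (E ⊕ δ) ⋆ exp (- 1#)) n        ≈⟨ ⋆-congʳ dilate-E+δ n ⟩
    ((exp (ι 2) ⊕ δ) ⋆ exp (- 1#)) n             ≈⟨ ⋆-distribʳ (exp (ι 2)) δ (exp (- 1#)) n ⟩
    (exp (ι 2) ⋆ exp (- 1#)) n + (δ ⋆ exp (- 1#)) n
      ≈⟨ +-cong (trans (exp-⋆-exp (ι 2) (- 1#) n) (pow-cong n 2-1≈1)) (δ-⋆ (exp (- 1#)) n) ⟩
    pow 1# n + pow (- 1#) n                      ≈⟨ E+exp[-1]≐2cosh n ⟩
    atEven (λ _ → ι 2) n                         ∎
    where
    2-1≈1 : ι 2 + - 1# ≈ 1#
    2-1≈1 = solve 0 (numeral 2 :+ :- con 1ℚ := con 1ℚ) refl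

    dilate-E+δ : dilate (ι 2) (E ⊕ δ) ≐ exp (ι 2) ⊕ δ
    dilate-E+δ zero    = solve 0 (con 1ℚ :* (con 1ℚ :+ con 1ℚ) := con 1ℚ :+ con 1ℚ) refl
    dilate-E+δ (suc n) = trans (*-congˡ (+-congʳ (pow-1# (suc n))))
      (solve 1 (λ p → p :* (con 1ℚ :+ con 0ℚ) := p :+ con 0ℚ) refl (pow (ι 2) (suc n)))

  tangent-egf : atEven (λ _ → ι 2) ⋆ dilate (ι 2) h ≐ dilate (ι 2) ((- 1#) · X) ⋆ exp (- 1#)
  tangent-egf n = begin
    (atEven (λ _ → ι 2) ⋆ H) n                    ≈⟨ ⋆-comm _ H n ⟩
    (H ⋆ atEven (λ _ → ι 2)) n                    ≈⟨ ⋆-congˡ dilate-E+δ⋆exp[-1] n ⟨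
    (H ⋆ (dilate (ι 2) (E ⊕ δ) ⋆ exp (- 1#))) n   ≈⟨ ⋆-assoc H _ _ n ⟨
    (H ⋆ dilate (ι 2) (E ⊕ δ) ⋆ exp (- 1#)) n     ≈⟨ ⋆-congʳ (dilate-⋆ (ι 2) h (E ⊕ δ)) n ⟨
    (dilate (ι 2) (h ⋆ (E ⊕ δ)) ⋆ exp (- 1#)) n   ≈⟨ ⋆-congʳ (*-congˡ ∘ h⋆E+δ) n ⟩
    (dilate (ι 2) ((- 1#) · X) ⋆ exp (- 1#)) n    ∎
    where
    H : Seq
    H = dilate (ι 2) h

  τ : Seq
  τ k = pow (ι 4) k * (pow (ι 4) k - 1#) * β (2 *ℕ k)

  dilate-h-double : ∀ k → dilate (ι 2) h (2 *ℕ k) ≈ τ k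
  dilate-h-double k = begin
    pow (ι 2) (2 *ℕ k) * (pow (ι 2) (2 *ℕ k) * β (2 *ℕ k) + - 1# * β (2 *ℕ k))
      ≈⟨ *-cong 4ᵏ (+-congʳ (*-congʳ 4ᵏ)) ⟩
    pow (ι 4) k * (pow (ι 4) k * β (2 *ℕ k) + - 1# * β (2 *ℕ k))
      ≈⟨ solve 2 (λ p b → p :* (p :* b :+ :- con 1ℚ :* b) := p :* (p :- con 1ℚ) :* b)
               refl (pow (ι 4) k) (β (2 *ℕ k)) ⟩
    τ k ∎
    where
    4ᵏ : pow (ι 2) (2 *ℕ k) ≈ pow (ι 4) k
    4ᵏ = trans (pow-double (ι 2) k) (pow-cong k (solve 0 (numeral 2 :* numeral 2 := numeral 4) refl))

  bernoulli-tangent : ∀ m → sumTo m (λ k → ι (2 *ℕ m C 2 *ℕ k) * τ (m ∸ k)) ≈ ι (2 *ℕ m)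
  bernoulli-tangent m = ι-suc-cancel ι⁻¹ ι⁻¹-inverse 1 (begin
    ι 2 * sumTo m G                               ≈⟨ sumTo-· m (ι 2) G ⟨
    sumTo m (ι 2 · G)                             ≈⟨ sumTo-cong m term ⟩
    sumTo m F                                     ≡⟨ ≡.cong (λ j → sumTo j F) (⌊2*n/2⌋≡n m) ⟨
    sumTo ⌊ 2 *ℕ m /2⌋ F                          ≈⟨ atEven-⋆ (λ _ → ι 2) (dilate (ι 2) h) (2 *ℕ m) ⟨
    (atEven (λ _ → ι 2) ⋆ dilate (ι 2) h) (2 *ℕ m) ≈⟨ tangent-egf (2 *ℕ m) ⟩
    (dilate (ι 2) ((- 1#) · X) ⋆ exp (- 1#)) (2 *ℕ m)
      ≈⟨ ⋆-congʳ dilate-[-X] (2 *ℕ m) ⟩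
    ((- 1# * ι 2) · X ⋆ exp (- 1#)) (2 *ℕ m)     ≈⟨ ·-⋆ (- 1# * ι 2) X (exp (- 1#)) (2 *ℕ m) ⟩
    - 1# * ι 2 * (X ⋆ exp (- 1#)) (2 *ℕ m)       ≈⟨ *-congˡ (X-⋆ (exp (- 1#)) (2 *ℕ m)) ⟩
    - 1# * ι 2 * (ι (2 *ℕ m) * pow (- 1#) (2 *ℕ m ∸ 1)) ≈⟨ coefficient m ⟩
    ι 2 * ι (2 *ℕ m)                              ∎)
    where
    F G : ℕ → Carrier
    F k = ι (2 *ℕ m C 2 *ℕ k) * ι 2 * dilate (ι 2) h (2 *ℕ m ∸ 2 *ℕ k)
    G k = ι (2 *ℕ m C 2 *ℕ k) * τ (m ∸ k)

    term : ∀ k → k ≤ m → ι 2 * G k ≈ F k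
    term k _ = begin
      ι 2 * (ι (2 *ℕ m C 2 *ℕ k) * τ (m ∸ k))
        ≈⟨ solve 3 (λ x c t → x :* (c :* t) := c :* x :* t) refl (ι 2) (ι (2 *ℕ m C 2 *ℕ k)) (τ (m ∸ k)) ⟩
      ι (2 *ℕ m C 2 *ℕ k) * ι 2 * τ (m ∸ k)
        ≈⟨ *-congˡ (dilate-h-double (m ∸ k)) ⟨
      ι (2 *ℕ m C 2 *ℕ k) * ι 2 * dilate (ι 2) h (2 *ℕ (m ∸ k))
        ≡⟨ ≡.cong (λ j → ι (2 *ℕ m C 2 *ℕ k) * ι 2 * dilate (ι 2) h j) (ℕ.*-distribˡ-∸ 2 m k) ⟩
      F k ∎

    dilate-[-X] : dilate (ι 2) ((- 1#) · X) ≐ (- 1# * ι 2) · X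
    dilate-[-X] n = begin
      pow (ι 2) n * (- 1# * X n)   ≈⟨ solve 3 (λ p u x → p :* (u :* x) := u :* (p :* x)) refl _ _ _ ⟩
      - 1# * dilate (ι 2) X n      ≈⟨ *-congˡ (dilate-2-X n) ⟩
      - 1# * (ι 2 * X n)           ≈⟨ *-assoc _ _ _ ⟨
      - 1# * ι 2 * X n             ∎

    coefficient : ∀ m → - 1# * ι 2 * (ι (2 *ℕ m) * pow (- 1#) (2 *ℕ m ∸ 1)) ≈ ι 2 * ι (2 *ℕ m)
    coefficient zero    = solve 0 (:- con 1ℚ :* numeral 2 :* (con 0ℚ :* con 1ℚ) := numeral 2 :* con 0ℚ) refl
    coefficient (suc m) = begin
      - 1# * ι 2 * (ι (2 *ℕ suc m) * pow (- 1#) (2 *ℕ suc m ∸ 1))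
        ≡⟨ ≡.cong (λ j → - 1# * ι 2 * (ι (2 *ℕ suc m) * pow (- 1#) (j ∸ 1))) (double-suc m) ⟩
      - 1# * ι 2 * (ι (2 *ℕ suc m) * pow (- 1#) (suc (2 *ℕ m)))
        ≈⟨ *-congˡ (*-congˡ (pow-[-1]-odd m)) ⟩
      - 1# * ι 2 * (ι (2 *ℕ suc m) * - 1#)
        ≈⟨ solve 1 (λ i → :- con 1ℚ :* numeral 2 :* (i :* :- con 1ℚ) := numeral 2 :* i) refl _ ⟩
      ι 2 * ι (2 *ℕ suc m) ∎

module Balancing {c ℓ} (R : CommutativeRing c ℓ) (φ : ℚ → CommutativeRing.Carrier R)
  (φ-hom : IsRingHomomorphism +-*-rawRing (CommutativeRing.rawRing R) φ)
  (x : CommutativeRing.Carrier R) where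

  open CommutativeRing R
  open RingDefs R
  open Series R
  open ℚ-Algebra R φ φ-hom
  open Bernoulli R φ φ-hom
  open import Relation.Binary.Reasoning.Setoid setoid

  M N t : Carrier
  M = ι 9 * (x * x) - 1#
  N = ι 36 * (x * x) * M
  t = ι 9 * (x * x) + M

  L B : ℕ → Carrier
  L k = lucasBalancing k x
  B k = balancing k x

  lucas-balancing-step : ∀ k → L (suc k) ≈ ι 3 * x * L k + M * B k × B (suc k) ≈ ι 3 * x * B k + L k
  lucas-balancing-step zero =
      solve 2 (λ x m → numeral 3 :* x := numeral 3 :* x :* con 1ℚ :+ m :* con 0ℚ) refl x M
    , solve 2 (λ x m → con 1ℚ := numeral 3 :* x :* con 0ℚ :+ con 1ℚ) refl x M
  lucas-balancing-step (suc k) =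
      (begin
        ι 6 * x * L (suc k) - L k                  ≈⟨ +-congʳ (*-congˡ IH-L) ⟩
        ι 6 * x * (ι 3 * x * L k + M * B k) - L k
          ≈⟨ solve 3 (λ x l b → numeral 6 :* x :* (numeral 3 :* x :* l :+ m x :* b) :- l
                                := numeral 3 :* x :* (numeral 3 :* x :* l :+ m x :* b)
                                   :+ m x :* (numeral 3 :* x :* b :+ l)) refl x (L k) (B k) ⟩
        ι 3 * x * (ι 3 * x * L k + M * B k) + M * (ι 3 * x * B k + L k)
          ≈⟨ +-cong (*-congˡ IH-L) (*-congˡ IH-B) ⟨
        ι 3 * x * L (suc k) + M * B (suc k)        ∎)
    , (begin
        ι 6 * x * B (suc k) - B k                  ≈⟨ +-congʳ (*-congˡ IH-B) ⟩
        ι 6 * x * (ι 3 * x * B k + L k) - B k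
          ≈⟨ solve 3 (λ x l b → numeral 6 :* x :* (numeral 3 :* x :* b :+ l) :- b
                                := numeral 3 :* x :* (numeral 3 :* x :* b :+ l)
                                   :+ (numeral 3 :* x :* l :+ m x :* b)) refl x (L k) (B k) ⟩
        ι 3 * x * (ι 3 * x * B k + L k) + (ι 3 * x * L k + M * B k)
          ≈⟨ +-cong (*-congˡ IH-B) IH-L ⟨
        ι 3 * x * B (suc k) + L (suc k)            ∎)
    where
    IH-L : L (suc k) ≈ ι 3 * x * L k + M * B k
    IH-L = proj₁ (lucas-balancing-step k)
    IH-B : B (suc k) ≈ ι 3 * x * B k + L k
    IH-B = proj₂ (lucas-balancing-step k)
    m : ∀ {n} → Polynomial n → Polynomial n
    m x = numeral 9 :* (x :* x) :- con 1ℚ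

  L-step : ∀ k → L (suc k) ≈ ι 3 * x * L k + M * B k
  L-step k = proj₁ (lucas-balancing-step k)

  B-step : ∀ k → B (suc k) ≈ ι 3 * x * B k + L k
  B-step k = proj₂ (lucas-balancing-step k)

  u v : Seq
  u j = L (2 *ℕ j)
  v j = ι 6 * x * M * B (2 *ℕ j)

  u≐exp⋆ch×v≐exp⋆sh : u ≐ exp t ⋆ ch N × v ≐ exp t ⋆ sh N
  u≐exp⋆ch×v≐exp⋆sh = coupled-recurrence t N u v refl (zeroʳ _) u-step v-step
    where
    two-steps : ∀ k → L (suc (suc k)) ≈ ι 3 * x * (ι 3 * x * L k + M * B k) + M * (ι 3 * x * B k + L k)
                    × B (suc (suc k)) ≈ ι 3 * x * (ι 3 * x * B k + L k) + (ι 3 * x * L k + M * B k)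
    two-steps k =
        trans (L-step (suc k)) (+-cong (*-congˡ (L-step k)) (*-congˡ (B-step k)))
      , trans (B-step (suc k)) (+-cong (*-congˡ (B-step k)) (L-step k))

    u-step : ∀ j → u (suc j) ≈ t * u j + v j
    u-step j = trans (reflexive (≡.cong L (double-suc j))) (trans (proj₁ (two-steps (2 *ℕ j)))
      (solve 4 (λ x m l b → numeral 3 :* x :* (numeral 3 :* x :* l :+ m :* b) :+ m :* (numeral 3 :* x :* b :+ l)
                            := (numeral 9 :* (x :* x) :+ m) :* l :+ numeral 6 :* x :* m :* b)
               refl x M (u j) (B (2 *ℕ j))))

    v-step : ∀ j → v (suc j) ≈ t * v j + N * u j
    v-step j = trans (*-congˡ (trans (reflexive (≡.cong B (double-suc j))) (proj₂ (two-steps (2 *ℕ j)))))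
      (solve 4 (λ x m l b → numeral 6 :* x :* m :* (numeral 3 :* x :* (numeral 3 :* x :* b :+ l)
                                                     :+ (numeral 3 :* x :* l :+ m :* b))
                            := (numeral 9 :* (x :* x) :+ m) :* (numeral 6 :* x :* m :* b)
                               :+ numeral 36 :* (x :* x) :* m :* l)
               refl x M (u j) (B (2 *ℕ j)))

  g : Seq
  g k = (pow (ι 4) k - 1#) * pow (ι 144 * (x * x) * M) k * β (2 *ℕ k)

  g≈Nᵏτ : g ≐ λ k → pow N k * τ k
  g≈Nᵏτ k = begin
    (pow (ι 4) k - 1#) * pow (ι 144 * (x * x) * M) k * β (2 *ℕ k)
      ≈⟨ *-congʳ (*-congˡ (trans (pow-cong k 144x²M≈4N) (pow-* (ι 4) N k))) ⟩
    (pow (ι 4) k - 1#) * (pow (ι 4) k * pow N k) * β (2 *ℕ k)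
      ≈⟨ solve 3 (λ p q b → (p :- con 1ℚ) :* (p :* q) :* b := q :* (p :* (p :- con 1ℚ) :* b))
               refl (pow (ι 4) k) (pow N k) (β (2 *ℕ k)) ⟩
    pow N k * τ k ∎
    where
    144x²M≈4N : ι 144 * (x * x) * M ≈ ι 4 * N
    144x²M≈4N = solve 2 (λ x m → numeral 144 :* (x :* x) :* m := numeral 4 :* (numeral 36 :* (x :* x) :* m))
                        refl x M

  atEven-g⋆u : atEven g ⋆ u ≐ X ⋆ v
  atEven-g⋆u n = begin
    (atEven g ⋆ u) n                   ≈⟨ ⋆-congˡ (proj₁ u≐exp⋆ch×v≐exp⋆sh) n ⟩
    (atEven g ⋆ (exp t ⋆ ch N)) n      ≈⟨ ⋆-left-comm (atEven g) (exp t) (ch N) n ⟩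
    (exp t ⋆ (atEven g ⋆ ch N)) n
      ≈⟨ ⋆-congˡ (λ i → trans (⋆-congʳ (atEven-cong g≈Nᵏτ) i) (ch-dilation N τ bernoulli-tangent i)) n ⟩
    (exp t ⋆ (X ⋆ sh N)) n             ≈⟨ ⋆-left-comm (exp t) X (sh N) n ⟩
    (X ⋆ (exp t ⋆ sh N)) n             ≈⟨ ⋆-congˡ (proj₂ u≐exp⋆ch×v≐exp⋆sh) n ⟨
    (X ⋆ v) n                          ∎

theorem8 : ∀ {c ℓ} (R : CommutativeRing c ℓ) (φ : ℚ → CommutativeRing.Carrier R)
  → IsRingHomomorphism +-*-rawRing (CommutativeRing.rawRing R) φ
  → (n : ℕ) (x : CommutativeRing.Carrier R)
  → let open CommutativeRing R
        open RingDefs R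
    in sumTo ⌊ n /2⌋ (λ k →
         ι (n C (2 *ℕ k)) * (pow (ι 4) k - 1#)
           * pow (ι 144 * (x * x) * (ι 9 * (x * x) - 1#)) k
           * φ (bernoulli (2 *ℕ k)) * lucasBalancing (2 *ℕ (n ∸ (2 *ℕ k))) x)
       ≈ ι 6 * ι n * x * (ι 9 * (x * x) - 1#) * balancing (2 *ℕ (n ∸ 1)) x
theorem8 R φ φ-hom n x = begin
  sumTo ⌊ n /2⌋ _
    ≈⟨ sumTo-cong ⌊ n /2⌋ (λ k _ → *-congʳ (trans (*-congʳ (*-assoc _ _ _)) (*-assoc _ _ _))) ⟩
  sumTo ⌊ n /2⌋ (λ k → ι (n C 2 *ℕ k) * g k * u (n ∸ 2 *ℕ k)) ≈⟨ atEven-⋆ g u n ⟨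
  (atEven g ⋆ u) n                                            ≈⟨ atEven-g⋆u n ⟩
  (X ⋆ v) n                                                   ≈⟨ X-⋆ v n ⟩
  ι n * (ι 6 * x * M * B (2 *ℕ (n ∸ 1)))
    ≈⟨ solve 4 (λ i x m b → i :* (numeral 6 :* x :* m :* b) := numeral 6 :* i :* x :* m :* b)
             refl (ι n) x M (B (2 *ℕ (n ∸ 1))) ⟩
  ι 6 * ι n * x * M * B (2 *ℕ (n ∸ 1))                        ∎
  where
  open CommutativeRing R
  open RingDefs R
  open Series R
  open ℚ-Algebra R φ φ-hom
  open Balancing R φ φ-hom x
  open import Relation.Binary.Reasoning.Setoid setoid
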